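{- For any integers $r\ge r'\ge 1$, $$\gamma_{\rm sp}(K_{1,r}\Box K_{1,r'})=rr'+1.$$
   Context: All graphs are finite, simple and undirected; $K_{1,r}$ is the star with $r$ leaves. For a vertex $v$, $N(v)$ is its set of neighbours; for $D\subseteq V(G)$, $\overline{D}=V(G)\setminus D$. A set $D\subseteq V(G)$ is a super dominating set of $G$ if for every $u\in\overline{D}$ there exists $v\in D$ such that $N(v)\cap\overline{D}=\{u\}$; the super domination number $\gamma_{\rm sp}(G)$ is the minimum cardinality of a super dominating set of $G$. The Cartesian product $G\Box H$ has vertex set $V(G)\times V(H)$, with $(g,h)$ adjacent to $(g',h')$ iff either $g=g'$ and $hh'\in E(H)$, or $gg'\in E(G)$ and $h=h'$. -}

module Defs where

open import Data.Nat using (ℕ; suc; _*_; _≤_)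
open import Data.Bool using (Bool; true; false; _∧_; _∨_)
open import Data.Fin using (Fin; zero; suc; remQuot; _≟_)
open import Data.Fin.Subset using (Subset; _∈_; _∉_; ∣_∣)
open import Data.Product using (Σ; ∃; _×_; _,_; proj₁; proj₂)
open import Relation.Binary.PropositionalEquality using (_≡_)
open import Relation.Nullary.Decidable using (⌊_⌋)
open import Function.Bundles using (_⇔_)

record Graph : Set where
  constructor mkGraph
  field
    order : ℕ
    adj   : Fin order → Fin order → Bool
open Graph public

star : ℕ → Graph
star r = mkGraph (suc r) a
  where
    a : Fin (suc r) → Fin (suc r) → Bool
    a zero    zero    = false
    a zero    (suc _) = true
    a (suc _) zero    = true
    a (suc _) (suc _) = false

-- Cartesian product G □ H; vertex set Fin (|G| * |H|) ≅ Fin |G| × Fin |H| via remQuot.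
_□_ : Graph → Graph → Graph
G □ H = mkGraph (order G * order H) a
  where
    a : Fin (order G * order H) → Fin (order G * order H) → Bool
    a x y with remQuot {order G} (order H) x | remQuot {order G} (order H) y
    ... | (g , h) | (g' , h') =
      (⌊ g ≟ g' ⌋ ∧ adj H h h') ∨ (adj G g g' ∧ ⌊ h ≟ h' ⌋)

IsSuperDominating : (G : Graph) → Subset (order G) → Set
IsSuperDominating G D =
  ∀ u → u ∉ D →
    ∃ λ v → v ∈ D × (∀ w → ((adj G v w ≡ true) × w ∉ D) ⇔ (w ≡ u))

SuperDominationNumber : Graph → ℕ → Set
SuperDominationNumber G k =
  (∃ λ D → IsSuperDominating G D × ∣ D ∣ ≡ k)
  × (∀ D → IsSuperDominating G D → k ≤ ∣ D ∣)

-- Call (i , 0) and (0 , j), for leaves i and j, the arm vertices of K₁,ᵣ □ K₁,ₛ: there are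
-- r + s of them, and every other vertex (the centre and the leaf pairs) has only arm
-- neighbours. Charge each vertex x outside a super dominating set D to x itself if x is an
-- arm, and otherwise to the vertex of D of which x is the only neighbour outside D, which is
-- then an arm. A vertex has at most one such neighbour, so the charging is injective and
-- |V ∖ D| ≤ r + s, i.e. |D| ≥ (r + 1)(s + 1) − (r + s) = rs + 1.
-- Conversely, for a map τ from the leaves of K₁,ᵣ to those of K₁,ₛ, the complement of the
-- r + s vertices (0 , j) and (i , τ i) is super dominating: (i , 0) dominates (i , τ i), and
-- (0 , j) is dominated by a leaf pair (i , j) with τ i ≠ j, or by the centre when s = 1.

module Submission where

open import Defs
open import Data.Nat using (ℕ; zero; suc; _*_; _+_; _≤_; z≤n; s≤s)
open import Data.Nat.Properties
  using (≤-trans; ≤-antisym; +-cancelʳ-≡; +-cancelʳ-≤; +-monoʳ-≤; m+[n∸m]≡n; module ≤-Reasoning)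
open import Data.Nat.Tactic.RingSolver using (solve-∀)
open import Data.Bool using (Bool; true; T; not; _∧_; _∨_)
open import Data.Bool.Properties using (T-≡; T-∧; T-∨)
open import Data.Fin using (Fin; zero; suc; remQuot; combine; splitAt; join; fromℕ; _≟_)
open import Data.Fin.Properties using (remQuot-combine; combine-remQuot; +↔⊎; 0≢1+n; suc-injective)
open import Data.Fin.Subset using (Subset; _∈_; _∉_; ∣_∣; ∁; ⊤; _-_; inside; outside)
open import Data.Fin.Subset.Properties
  using (∣⊤∣≡n; ∣∁p∣≡n∸∣p∣; ∣p∣≤n; ∈⊤; x∈∁p⇒x∉p; x∉p⇒x∈∁p; x∈p∧x≢y⇒x∈p-y; x∈p⇒∣p-x∣<∣p∣)
open import Data.Vec using ([]; _∷_; tabulate)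
open import Data.Vec.Base using (here; there)
open import Data.Vec.Properties using ([]=⇒lookup; lookup⇒[]=; lookup∘tabulate)
open import Data.Product using (Σ; ∃; _×_; _,_; proj₁; proj₂; uncurry)
open import Data.Sum using (_⊎_; inj₁; inj₂)
open import Function using (_∘_)
open import Function.Bundles using (_⇔_; mk⇔; Equivalence; Injection)
open import Function.Properties.Inverse using (↔⇒↣; ↔-sym)
open import Relation.Nullary using (¬_; Dec; yes; no; contradiction)
open import Relation.Nullary.Decidable
  using (⌊_⌋; toWitness; fromWitness; toWitnessFalse; fromWitnessFalse; decidable-stable)
open import Relation.Binary.PropositionalEquality using (_≡_; _≢_; refl; sym; trans; cong; subst)

open Equivalence using (to; from)

injection⇒∣p∣≤∣q∣ : ∀ {m n} (p : Subset m) (q : Subset n) (f : ∀ {x} → x ∈ p → Fin n) →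
  (∀ {x} (x∈p : x ∈ p) → f x∈p ∈ q) →
  (∀ {x y} (x∈p : x ∈ p) (y∈p : y ∈ p) → f x∈p ≡ f y∈p → x ≡ y) →
  ∣ p ∣ ≤ ∣ q ∣
injection⇒∣p∣≤∣q∣ []            q f f∈q f-inj = z≤n
injection⇒∣p∣≤∣q∣ (outside ∷ p) q f f∈q f-inj =
  injection⇒∣p∣≤∣q∣ p q (f ∘ there) (f∈q ∘ there)
    (λ x∈p y∈p → suc-injective ∘ f-inj (there x∈p) (there y∈p))
injection⇒∣p∣≤∣q∣ (inside ∷ p) q f f∈q f-inj =
  ≤-trans (s≤s ∣p∣≤∣q-f₀∣) (x∈p⇒∣p-x∣<∣p∣ (f∈q here))
  where
  ∣p∣≤∣q-f₀∣ : ∣ p ∣ ≤ ∣ q - f here ∣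
  ∣p∣≤∣q-f₀∣ = injection⇒∣p∣≤∣q∣ p (q - f here) (f ∘ there)
    (λ x∈p → x∈p∧x≢y⇒x∈p-y (f∈q (there x∈p)) (0≢1+n ∘ sym ∘ f-inj (there x∈p) here))
    (λ x∈p y∈p → suc-injective ∘ f-inj (there x∈p) (there y∈p))

∣p∣+∣∁p∣≡n : ∀ {n} (p : Subset n) → ∣ p ∣ + ∣ ∁ p ∣ ≡ n
∣p∣+∣∁p∣≡n p = trans (cong (∣ p ∣ +_) (∣∁p∣≡n∸∣p∣ p)) (m+[n∸m]≡n (∣p∣≤n p))

∣∁p∣≤m⇒k≤∣p∣ : ∀ {n k m} (p : Subset n) → n ≡ k + m → ∣ ∁ p ∣ ≤ m → k ≤ ∣ p ∣
∣∁p∣≤m⇒k≤∣p∣ {n} {k} {m} p n≡k+m ∣∁p∣≤m = +-cancelʳ-≤ m k ∣ p ∣ (begin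
  k + m            ≡⟨ sym n≡k+m ⟩
  n                ≡⟨ sym (∣p∣+∣∁p∣≡n p) ⟩
  ∣ p ∣ + ∣ ∁ p ∣  ≤⟨ +-monoʳ-≤ ∣ p ∣ ∣∁p∣≤m ⟩
  ∣ p ∣ + m        ∎)
  where open ≤-Reasoning

∣∁p∣≡m⇒∣p∣≡k : ∀ {n k m} (p : Subset n) → n ≡ k + m → ∣ ∁ p ∣ ≡ m → ∣ p ∣ ≡ k
∣∁p∣≡m⇒∣p∣≡k {k = k} {m} p n≡k+m ∣∁p∣≡m =
  +-cancelʳ-≡ m ∣ p ∣ k (trans (cong (∣ p ∣ +_) (sym ∣∁p∣≡m)) (trans (∣p∣+∣∁p∣≡n p) n≡k+m))

PrivateNeighbour : (G : Graph) → Subset (order G) → Fin (order G) → Fin (order G) → Set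
PrivateNeighbour G D v x = ∀ w → ((adj G v w ≡ true) × w ∉ D) ⇔ (w ≡ x)

data StarEdge {n : ℕ} : Fin (suc n) → Fin (suc n) → Set where
  centre-leaf : ∀ i → StarEdge zero (suc i)
  leaf-centre : ∀ i → StarEdge (suc i) zero

StarEdge⇒adj : ∀ {n} {a b : Fin (suc n)} → StarEdge a b → T (adj (star n) a b)
StarEdge⇒adj (centre-leaf i) = _
StarEdge⇒adj (leaf-centre i) = _

adj⇒StarEdge : ∀ {n} (a b : Fin (suc n)) → T (adj (star n) a b) → StarEdge a b
adj⇒StarEdge zero    (suc i) _ = centre-leaf i
adj⇒StarEdge (suc i) zero    _ = leaf-centre i

Pos : ℕ → ℕ → Set
Pos r s = Fin (suc r) × Fin (suc s)

data Edge {r s : ℕ} : Pos r s → Pos r s → Set where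
  edge₁ : ∀ {g g'} h → StarEdge g g' → Edge (g , h) (g' , h)
  edge₂ : ∀ g {h h'} → StarEdge h h' → Edge (g , h) (g , h')

-- The adjacency of star r □ star s on coordinate pairs; at (pos x , pos y) it is
-- definitionally adj (star r □ star s) x y.
□-adj : ∀ {r s} → Pos r s → Pos r s → Bool
□-adj {r} {s} (g , h) (g' , h') =
  (⌊ g ≟ g' ⌋ ∧ adj (star s) h h') ∨ (adj (star r) g g' ∧ ⌊ h ≟ h' ⌋)

Edge⇒□-adj : ∀ {r s} {p q : Pos r s} → Edge p q → T (□-adj p q)
Edge⇒□-adj {s = s} (edge₁ {g} {g'} h e) = from (T-∨ {⌊ g ≟ g' ⌋ ∧ adj (star s) h h})
  (inj₂ (from T-∧ (StarEdge⇒adj e , fromWitness {a? = h ≟ h} refl)))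
Edge⇒□-adj {s = s} (edge₂ g {h} {h'} e) = from (T-∨ {⌊ g ≟ g ⌋ ∧ adj (star s) h h'})
  (inj₁ (from T-∧ (fromWitness {a? = g ≟ g} refl , StarEdge⇒adj e)))

□-adj⇒Edge : ∀ {r s} (p q : Pos r s) → T (□-adj p q) → Edge p q
□-adj⇒Edge (g , h) (g' , h') t with to T-∨ t
... | inj₁ t₁ with to T-∧ t₁
...   | g≟g' , hh' with refl ← toWitness {a? = g ≟ g'} g≟g' = edge₂ g (adj⇒StarEdge h h' hh')
□-adj⇒Edge (g , h) (g' , h') t | inj₂ t₂ with to T-∧ t₂
...   | gg' , h≟h' with refl ← toWitness {a? = h ≟ h'} h≟h' = edge₁ h (adj⇒StarEdge g g' gg')

module Coordinates (r s : ℕ) where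

  pos : Fin (suc r * suc s) → Pos r s
  pos = remQuot (suc s)

  vertex : Pos r s → Fin (suc r * suc s)
  vertex = uncurry combine

  pos-vertex : ∀ p → pos (vertex p) ≡ p
  pos-vertex (g , h) = remQuot-combine g h

  pos-injective : ∀ {x y} → pos x ≡ pos y → x ≡ y
  pos-injective {x} {y} e =
    trans (sym (combine-remQuot (suc s) x)) (trans (cong vertex e) (combine-remQuot (suc s) y))

  vertex-injective : ∀ {p q} → vertex p ≡ vertex q → p ≡ q
  vertex-injective {p} {q} e = trans (sym (pos-vertex p)) (trans (cong pos e) (pos-vertex q))

  adj⇔Edge : ∀ x y → adj (star r □ star s) x y ≡ true ⇔ Edge (pos x) (pos y)
  adj⇔Edge x y = mk⇔ (□-adj⇒Edge (pos x) (pos y) ∘ from T-≡) (to T-≡ ∘ Edge⇒□-adj)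

data Arm {r s : ℕ} : Pos r s → Set where
  arm₁ : ∀ i → Arm (suc i , zero)
  arm₂ : ∀ j → Arm (zero , suc j)

arm? : ∀ {r s} (p : Pos r s) → Dec (Arm p)
arm? (zero  , zero)  = no λ ()
arm? (zero  , suc j) = yes (arm₂ j)
arm? (suc i , zero)  = yes (arm₁ i)
arm? (suc i , suc j) = no λ ()

armSide : ∀ {r s} {p : Pos r s} → Arm p → Fin r ⊎ Fin s
armSide (arm₁ i) = inj₁ i
armSide (arm₂ j) = inj₂ j

armSide-injective : ∀ {r s} {p q : Pos r s} (a : Arm p) (b : Arm q) →
  armSide a ≡ armSide b → p ≡ q
armSide-injective (arm₁ i) (arm₁ .i) refl = refl
armSide-injective (arm₁ i) (arm₂ j)  ()
armSide-injective (arm₂ j) (arm₁ i)  ()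
armSide-injective (arm₂ j) (arm₂ .j) refl = refl

armIndex : ∀ {r s} {p : Pos r s} → Arm p → Fin (r + s)
armIndex {r} {s} = join r s ∘ armSide

armIndex-injective : ∀ {r s} {p q : Pos r s} (a : Arm p) (b : Arm q) →
  armIndex a ≡ armIndex b → p ≡ q
armIndex-injective {r} {s} a b =
  armSide-injective a b ∘ Injection.injective (↔⇒↣ (↔-sym (+↔⊎ {r} {s})))

nonArm-neighbour : ∀ {r s} {p q : Pos r s} → ¬ Arm p → Edge q p → Arm q
nonArm-neighbour {p = _ , zero}  ¬a (edge₁ _ (centre-leaf i)) = contradiction (arm₁ i) ¬a
nonArm-neighbour {p = _ , suc j} ¬a (edge₁ _ (centre-leaf i)) = arm₂ j
nonArm-neighbour {p = _ , zero}  ¬a (edge₁ _ (leaf-centre i)) = arm₁ i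
nonArm-neighbour {p = _ , suc j} ¬a (edge₁ _ (leaf-centre i)) = contradiction (arm₂ j) ¬a
nonArm-neighbour {p = zero  , _} ¬a (edge₂ _ (centre-leaf j)) = contradiction (arm₂ j) ¬a
nonArm-neighbour {p = suc i , _} ¬a (edge₂ _ (centre-leaf j)) = arm₁ i
nonArm-neighbour {p = zero  , _} ¬a (edge₂ _ (leaf-centre j)) = arm₂ j
nonArm-neighbour {p = suc i , _} ¬a (edge₂ _ (leaf-centre j)) = contradiction (arm₁ i) ¬a

module _ {r s : ℕ} {D : Subset (suc r * suc s)}
         (D-sd : IsSuperDominating (star r □ star s) D) where

  open Coordinates r s

  data Charged (x : Fin (suc r * suc s)) : Fin (suc r * suc s) → Set where
    self      : x ∉ D → Arm (pos x) → Charged x x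
    dominator : ∀ {v} → ¬ Arm (pos x) → v ∈ D →
                PrivateNeighbour (star r □ star s) D v x → Charged x v

  charge : ∀ x → x ∉ D → ∃ (Charged x)
  charge x x∉D with arm? (pos x) | D-sd x x∉D
  ... | yes a  | _           = x , self x∉D a
  ... | no ¬a  | v , v∈D , pn = v , dominator ¬a v∈D pn

  charged-arm : ∀ {x c} → Charged x c → Arm (pos c)
  charged-arm (self _ a)            = a
  charged-arm {x} (dominator {v} ¬a _ pn) =
    nonArm-neighbour ¬a (to (adj⇔Edge v x) (proj₁ (from (pn x) refl)))

  charged-injective : ∀ {x y c} → Charged x c → Charged y c → x ≡ y
  charged-injective (self _ _)          (self _ _)          = refl
  charged-injective (self x∉D _)        (dominator _ x∈D _) = contradiction x∈D x∉D
  charged-injective (dominator _ y∈D _) (self y∉D _)        = contradiction y∈D y∉D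
  charged-injective {x} (dominator _ _ pnx) (dominator _ _ pny) = to (pny x) (from (pnx x) refl)

  chargedIndex-injective : ∀ {x y c c'} (cx : Charged x c) (cy : Charged y c') →
    armIndex (charged-arm cx) ≡ armIndex (charged-arm cy) → x ≡ y
  chargedIndex-injective {c = c} {c'} cx cy e
    with refl ← pos-injective {c} {c'} (armIndex-injective (charged-arm cx) (charged-arm cy) e) =
    charged-injective cx cy

  ∣∁D∣≤r+s : ∣ ∁ D ∣ ≤ r + s
  ∣∁D∣≤r+s = subst (∣ ∁ D ∣ ≤_) (∣⊤∣≡n (r + s))
    (injection⇒∣p∣≤∣q∣ (∁ D) ⊤ index (λ _ → ∈⊤)
      (λ x∈ y∈ → chargedIndex-injective (proj₂ (charge′ x∈)) (proj₂ (charge′ y∈))))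
    where
    charge′ : ∀ {x} → x ∈ ∁ D → ∃ (Charged x)
    charge′ x∈∁D = charge _ (x∈∁p⇒x∉p x∈∁D)

    index : ∀ {x} → x ∈ ∁ D → Fin (r + s)
    index = armIndex ∘ charged-arm ∘ proj₂ ∘ charge′

∈-tabulate⇔ : ∀ {n} (f : Fin n → Bool) {x} → x ∈ tabulate f ⇔ T (f x)
∈-tabulate⇔ f {x} = mk⇔
  (λ x∈ → from T-≡ (trans (sym (lookup∘tabulate f x)) ([]=⇒lookup x∈)))
  (λ t → lookup⇒[]= x (tabulate f) (trans (lookup∘tabulate f x) (to T-≡ t)))

module _ {r s : ℕ} (τ : Fin r → Fin s) where

  open Coordinates r s

  data Out : Pos r s → Set where
    arm₂    : ∀ j → Out (zero , suc j)
    matched : ∀ i {j} → j ≡ τ i → Out (suc i , suc j)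

  Out? : ∀ p → Dec (Out p)
  Out? (zero  , zero)  = no λ ()
  Out? (zero  , suc j) = yes (arm₂ j)
  Out? (suc i , zero)  = no λ ()
  Out? (suc i , suc j) with j ≟ τ i
  ... | yes j≡τi = yes (matched i j≡τi)
  ... | no  j≢τi = no λ { (matched _ j≡τi) → j≢τi j≡τi }

  Dominates : Pos r s → Pos r s → Set
  Dominates v u = ¬ Out v × Edge v u × (∀ {q} → Edge v q → Out q → q ≡ u)

  Escapes : Set
  Escapes = ∀ j → (∃ λ i → τ i ≢ j) ⊎ (∀ j' → j' ≡ j)

  dominator-of : Escapes → ∀ {u} → Out u → ∃ λ v → Dominates v u
  dominator-of _ (matched i {j} j≡τi) =
    (suc i , zero) , (λ ()) , edge₂ (suc i) (centre-leaf j) , only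
    where
    only : ∀ {q} → Edge (suc i , zero) q → Out q → q ≡ (suc i , suc j)
    only (edge₂ _ (centre-leaf j')) (matched _ j'≡τi) =
      cong (λ k → suc i , suc k) (trans j'≡τi (sym j≡τi))
    only (edge₁ _ (leaf-centre _)) ()
  dominator-of escapes (arm₂ j) with escapes j
  ... | inj₁ (i , τi≢j) =
    (suc i , suc j) , (λ { (matched _ j≡τi) → τi≢j (sym j≡τi) }) ,
    edge₁ (suc j) (leaf-centre i) , only
    where
    only : ∀ {q} → Edge (suc i , suc j) q → Out q → q ≡ (zero , suc j)
    only (edge₁ _ (leaf-centre _)) _  = refl
    only (edge₂ _ (leaf-centre _)) ()
  ... | inj₂ j-sole = (zero , zero) , (λ ()) , edge₂ zero (centre-leaf j) , only
    where
    only : ∀ {q} → Edge (zero , zero) q → Out q → q ≡ (zero , suc j)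
    only (edge₂ _ (centre-leaf j')) _ = cong (λ k → zero , suc k) (j-sole j')
    only (edge₁ _ (centre-leaf _)) ()

  notOut : Fin (suc r * suc s) → Bool
  notOut x = not ⌊ Out? (pos x) ⌋

  D₀ : Subset (suc r * suc s)
  D₀ = tabulate notOut

  ¬Out⇒∈D₀ : ∀ {x} → ¬ Out (pos x) → x ∈ D₀
  ¬Out⇒∈D₀ {x} = from (∈-tabulate⇔ notOut) ∘ fromWitnessFalse {a? = Out? (pos x)}

  ∉D₀⇒Out : ∀ {x} → x ∉ D₀ → Out (pos x)
  ∉D₀⇒Out x∉D₀ = decidable-stable (Out? _) (x∉D₀ ∘ ¬Out⇒∈D₀)

  Out⇒∈∁D₀ : ∀ {x} → Out (pos x) → x ∈ ∁ D₀
  Out⇒∈∁D₀ {x} out = x∉p⇒x∈∁p λ x∈D₀ →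
    toWitnessFalse {a? = Out? (pos x)} (to (∈-tabulate⇔ notOut) x∈D₀) out

  D₀-superDominating : Escapes → IsSuperDominating (star r □ star s) D₀
  D₀-superDominating escapes u u∉D₀ with dominator-of escapes (∉D₀⇒Out u∉D₀)
  ... | p , dom with subst (λ q → Dominates q (pos u)) (sym (pos-vertex p)) dom
  ...   | ¬out , v→u , only = vertex p , ¬Out⇒∈D₀ ¬out , λ w → mk⇔
    (λ (v~w , w∉D₀) → pos-injective (only (to (adj⇔Edge (vertex p) w) v~w) (∉D₀⇒Out w∉D₀)))
    (λ { refl → from (adj⇔Edge (vertex p) u) v→u , u∉D₀ })

  outPos : Fin r ⊎ Fin s → Pos r s
  outPos (inj₁ i) = suc i , suc (τ i)
  outPos (inj₂ j) = zero , suc j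

  outPos-Out : ∀ a → Out (outPos a)
  outPos-Out (inj₁ i) = matched i refl
  outPos-Out (inj₂ j) = arm₂ j

  outPos-injective : ∀ {a b} → outPos a ≡ outPos b → a ≡ b
  outPos-injective {inj₁ i} {inj₁ .i} refl = refl
  outPos-injective {inj₂ j} {inj₂ .j} refl = refl

  r+s≤∣∁D₀∣ : r + s ≤ ∣ ∁ D₀ ∣
  r+s≤∣∁D₀∣ = subst (_≤ ∣ ∁ D₀ ∣) (∣⊤∣≡n (r + s))
    (injection⇒∣p∣≤∣q∣ ⊤ (∁ D₀) (λ {k} _ → outVertex k)
      (λ {k} _ → Out⇒∈∁D₀ (outVertex-Out k)) (λ _ _ → outVertex-injective))
    where
    outVertex : Fin (r + s) → Fin (suc r * suc s)
    outVertex = vertex ∘ outPos ∘ splitAt r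

    outVertex-Out : ∀ k → Out (pos (outVertex k))
    outVertex-Out k = subst Out (sym (pos-vertex _)) (outPos-Out (splitAt r k))

    outVertex-injective : ∀ {k k'} → outVertex k ≡ outVertex k' → k ≡ k'
    outVertex-injective =
      Injection.injective (↔⇒↣ (+↔⊎ {r} {s})) ∘ outPos-injective ∘ vertex-injective

firstToLast : ∀ {r s} → Fin (suc r) → Fin (suc s)
firstToLast {s = s} zero    = fromℕ s
firstToLast         (suc _) = zero

firstToLast-escapes : ∀ {r s} → s ≤ r → Escapes (firstToLast {r} {s})
firstToLast-escapes {s = zero}  _       zero    = inj₂ λ { zero → refl }
firstToLast-escapes {s = suc _} _       zero    = inj₁ (zero , λ ())
firstToLast-escapes {s = suc _} (s≤s _) (suc j) = inj₁ (suc zero , λ ())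

escapingMatching : ∀ {r s} → 1 ≤ s → s ≤ r → Σ (Fin r → Fin s) Escapes
escapingMatching {suc r} {suc s} _ (s≤s s≤r) = firstToLast , firstToLast-escapes s≤r

vertexCount : ∀ r s → suc r * suc s ≡ (r * s + 1) + (r + s)
vertexCount = solve-∀

theorem33 : (r r' : ℕ) → 1 ≤ r' → r' ≤ r →
    SuperDominationNumber (star r □ star r') (r * r' + 1)
theorem33 r r' 1≤r' r'≤r = (D₀ τ , D₀-sd , ∣D₀∣≡rr'+1) , minimal
  where
  τ : Fin r → Fin r'
  τ = proj₁ (escapingMatching 1≤r' r'≤r)

  D₀-sd : IsSuperDominating (star r □ star r') (D₀ τ)
  D₀-sd = D₀-superDominating τ (proj₂ (escapingMatching 1≤r' r'≤r))

  ∣D₀∣≡rr'+1 : ∣ D₀ τ ∣ ≡ r * r' + 1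
  ∣D₀∣≡rr'+1 = ∣∁p∣≡m⇒∣p∣≡k (D₀ τ) (vertexCount r r') (≤-antisym (∣∁D∣≤r+s D₀-sd) (r+s≤∣∁D₀∣ τ))

  minimal : ∀ D → IsSuperDominating (star r □ star r') D → r * r' + 1 ≤ ∣ D ∣
  minimal D D-sd = ∣∁p∣≤m⇒k≤∣p∣ D (vertexCount r r') (∣∁D∣≤r+s D-sd)
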